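{- Let $k$ be a multiple of $4$ with $4\le k\le 2^{n/4}$ and $k\le n$. There is a deterministic OBDD on $n$ variables of width $8\cdot 2^{k/4}-5$ computing $\mathtt{EQS^k_{n}}$.
   Context: For $\nu\in\{0,1\}^n$, among the first $k$ bits, call the odd positions marker bits and the even positions value bits. For $1\le i\le k/2$, the value bit $\nu_{2i}$ is appended (in order of increasing $i$) to the string $\alpha(\nu)$ if $\nu_{2i-1}=0$ and to the string $\beta(\nu)$ if $\nu_{2i-1}=1$. $\mathtt{EQS^k_{n}}(\nu)=1$ if $\alpha(\nu)=\beta(\nu)$ (as strings) and $0$ otherwise. A deterministic OBDD on $x_1,\dots,x_n$ with order $\pi$ (a permutation of $\{1,\dots,n\}$) is a leveled directed acyclic graph with levels $0,\dots,n$, a single source at level $0$, every node at level $j-1$ having exactly one outgoing edge labelled $0$ and one labelled $1$ to nodes at level $j$, and nodes at level $n$ marked accepting or rejecting; on input $\nu$ one follows from the source at step $j$ the edge labelled $\nu_{\pi(j)}$ and outputs $1$ iff an accepting node is reached. Width is the maximum number of nodes in a level. -}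

module Defs where

open import Data.Nat using (ℕ; zero; suc; _+_; _*_; _∸_; _^_; _≤_; _<_; _/_)
open import Data.Nat.Properties using (<⇒≤)
open import Data.Fin using (Fin; zero; fromℕ<; toℕ)
open import Data.Fin.Permutation using (Permutation′; _⟨$⟩ʳ_)
open import Data.Bool using (Bool; true; false; if_then_else_)
import Data.Bool.Properties as BoolP
open import Data.List using (List; []; _∷_; _++_)
open import Data.List.Properties using (≡-dec)
open import Relation.Nullary.Decidable using (⌊_⌋)
open import Relation.Nullary using (yes; no)
open import Data.Nat using (_<?_)
open import Data.Nat.Properties using (≤-refl)
open import Relation.Binary.PropositionalEquality using (_≡_; subst; sym)

-- Bit at 0-based position p of ν (false if out of range; never used
-- out of range since k ≤ n).
bitAt : {n : ℕ} → (Fin n → Bool) → ℕ → Bool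
bitAt {n} ν p with p <? n
... | yes q = ν (fromℕ< q)
... | no _ = false

-- Paper positions are 1-based: marker ν_{2i-1} is 0-based index 2(i-1),
-- value ν_{2i} is 0-based index 2(i-1)+1.
-- alphaPre ν m / betaPre ν m : strings built from the first m pairs.
alphaPre : {n : ℕ} → (Fin n → Bool) → ℕ → List Bool
alphaPre ν zero = []
alphaPre ν (suc m) =
  alphaPre ν m ++ (if bitAt ν (2 * m) then [] else (bitAt ν (2 * m + 1) ∷ []))

betaPre : {n : ℕ} → (Fin n → Bool) → ℕ → List Bool
betaPre ν zero = []
betaPre ν (suc m) =
  betaPre ν m ++ (if bitAt ν (2 * m) then (bitAt ν (2 * m + 1) ∷ []) else [])

α β : {n : ℕ} → ℕ → (Fin n → Bool) → List Bool
α k ν = alphaPre ν (k / 2)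
β k ν = betaPre ν (k / 2)

EQS : (k n : ℕ) → (Fin n → Bool) → Bool
EQS k n ν = ⌊ ≡-dec BoolP._≟_ (α k ν) (β k ν) ⌋

record OBDD (n : ℕ) : Set where
  field
    order  : Permutation′ n
    size   : ℕ → ℕ
    source : size 0 ≡ 1
    edge   : (j : ℕ) → j < n → Fin (size j) → Bool → Fin (size (suc j))
    accept : Fin (size n) → Bool

  start : Fin (size 0)
  start = subst Fin (sym source) zero

  reach : (Fin n → Bool) → (m : ℕ) → m ≤ n → Fin (size m)
  reach ν zero _ = start
  reach ν (suc m) p = edge m p (reach ν m (<⇒≤ p)) (ν (order ⟨$⟩ʳ fromℕ< p))

  eval : (Fin n → Bool) → Bool
  eval ν = accept (reach ν n ≤-refl)

  HasWidthAtMost : ℕ → Set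
  HasWidthAtMost w = (j : ℕ) → j ≤ n → size j ≤ w

  Computes : ((Fin n → Bool) → Bool) → Set
  Computes f = (ν : Fin n → Bool) → eval ν ≡ f ν

-- Read the (marker, value) pairs from left to right, keeping only how α and β
-- differ so far: either one is a prefix of the other, and it suffices to remember
-- which one is ahead and by which word, or they have diverged and the input is
-- rejected. If α = β at the end then both have length d = k/4, since the k/2 values
-- are split evenly, so an excess longer than d is rejected at once. The balanced
-- state and the 2(2^(d+1) - 2) excess states, each with a pending marker bit, plus
-- one rejecting sink give 2(4·2^d - 3) + 1 = 8·2^d - 5 nodes per level.
module Submission where

open import Defs
open import Data.Nat using (ℕ; zero; suc; _+_; _*_; _∸_; _^_; _≤_; _<_; _/_; z≤n; s≤s; z<s; _<?_)
open import Data.Nat.Properties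
open import Data.Nat.DivMod using (m*n/n≡m)
open import Data.Nat.Divisibility using (_∣_; divides)
open import Data.Nat.Tactic.RingSolver using (solve-∀)
open import Data.Fin using (Fin; zero; suc; fromℕ<; _↑ˡ_; _↑ʳ_; splitAt)
open import Data.Fin.Properties using (splitAt-↑ˡ; splitAt-↑ʳ)
import Data.Fin.Permutation as Permutation
open import Data.Bool using (Bool; true; false; if_then_else_)
import Data.Bool.Properties as Bool
open import Data.Maybe using (Maybe; nothing; just; _>>=_)
open import Data.List using (List; []; _∷_; _++_; length)
open import Data.List.Properties
  using (≡-dec; ++-assoc; ++-identityʳ; ++-identityʳ-unique; ++-cancelˡ; ∷-injectiveˡ;
         length-++; length-++-≤ˡ; length-++-≤ʳ)
open import Data.Product using (Σ; _×_; _,_)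
open import Data.Sum using ([_,_]′)
open import Data.Empty using (⊥-elim)
open import Data.Unit using (⊤; tt)
open import Function using (_∘_)
open import Relation.Nullary using (yes; no; contradiction)
open import Relation.Nullary.Decidable using (⌊_⌋)
open import Relation.Binary.PropositionalEquality

run : {State : Set} → State → (ℕ → State → Bool → State) → (ℕ → Bool) → ℕ → State
run start step x zero    = start
run start step x (suc m) = step m (run start step x m) (x m)

record Automaton (State : Set) (w : ℕ) : Set₁ where
  field
    Good          : State → Set
    start         : State
    step          : ℕ → State → Bool → State
    accept        : State → Bool
    encode        : State → Fin w
    decode        : Fin w → State
    start-good    : Good start
    step-good     : ∀ j s b → Good s → Good (step j s b)
    decode-encode : ∀ s → Good s → decode (encode s) ≡ s

  run-good : ∀ x m → Good (run start step x m)
  run-good x zero    = start-good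
  run-good x (suc m) = step-good m _ (x m) (run-good x m)

bitAt-fromℕ< : ∀ {n m} (ν : Fin n → Bool) (p : m < n) → bitAt ν m ≡ ν (fromℕ< p)
bitAt-fromℕ< {n} {m} ν p with m <? n
... | yes q = cong (λ r → ν (fromℕ< r)) (<-irrelevant q p)
... | no m≮n = contradiction p m≮n

module _ {State : Set} {w : ℕ} (A : Automaton State w) (n : ℕ) where
  open Automaton A

  levelSize : ℕ → ℕ
  levelSize zero    = 1
  levelSize (suc _) = w

  decodeAt : (j : ℕ) → Fin (levelSize j) → State
  decodeAt zero    _ = start
  decodeAt (suc j) x = decode x

  toOBDD : OBDD n
  toOBDD = record
    { order  = Permutation.id
    ; size   = levelSize
    ; source = refl
    ; edge   = λ j _ x b → encode (step j (decodeAt j x) b)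
    ; accept = λ x → accept (decodeAt n x)
    }

  toOBDD-width : OBDD.HasWidthAtMost toOBDD w
  toOBDD-width zero    _ = positive (encode start)
    where
    positive : ∀ {m} → Fin m → 1 ≤ m
    positive zero    = s≤s z≤n
    positive (suc _) = s≤s z≤n
  toOBDD-width (suc j) _ = ≤-refl

  decodeAt-reach : ∀ ν m (p : m ≤ n) → decodeAt m (OBDD.reach toOBDD ν m p) ≡ run start step (bitAt ν) m
  decodeAt-reach ν zero    _ = refl
  decodeAt-reach ν (suc m) p = begin
      decode (encode (step m (decodeAt m (OBDD.reach toOBDD ν m (<⇒≤ p))) (ν (fromℕ< p))))
    ≡⟨ cong₂ (λ s b → decode (encode (step m s b))) (decodeAt-reach ν m (<⇒≤ p)) (sym (bitAt-fromℕ< ν p)) ⟩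
      decode (encode (run start step (bitAt ν) (suc m)))
    ≡⟨ decode-encode _ (run-good (bitAt ν) (suc m)) ⟩
      run start step (bitAt ν) (suc m)
    ∎
    where open ≡-Reasoning

  automaton⇒OBDD : ∀ {f} → (∀ ν → accept (run start step (bitAt ν) n) ≡ f ν) →
                   Σ (OBDD n) λ B → OBDD.HasWidthAtMost B w × OBDD.Computes B f
  automaton⇒OBDD accepts-f =
    toOBDD , toOBDD-width , λ ν → trans (cong accept (decodeAt-reach ν n ≤-refl)) (accepts-f ν)

tag : ∀ {n} → Bool → Fin n → Fin (n + n)
tag {n} false i = i ↑ˡ n
tag {n} true  i = n ↑ʳ i

untag : ∀ {n} → Fin (n + n) → Bool × Fin n
untag {n} i = [ (false ,_) , (true ,_) ]′ (splitAt n i)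

untag-tag : ∀ {n} b (i : Fin n) → untag (tag b i) ≡ (b , i)
untag-tag {n} false i = cong [ (false ,_) , (true ,_) ]′ (splitAt-↑ˡ n i n)
untag-tag {n} true  i = cong [ (false ,_) , (true ,_) ]′ (splitAt-↑ʳ n n i)

countLists≤ : ℕ → ℕ
countLists≤ zero    = 1
countLists≤ (suc L) = suc (countLists≤ L + countLists≤ L)

-- Lists longer than the bound are truncated, so that encodeList is total.
encodeList : (L : ℕ) → List Bool → Fin (countLists≤ L)
encodeList zero    _       = zero
encodeList (suc L) []      = zero
encodeList (suc L) (b ∷ w) = suc (tag b (encodeList L w))

decodeList : (L : ℕ) → Fin (countLists≤ L) → List Bool
decodeList zero    _       = []
decodeList (suc L) zero    = []
decodeList (suc L) (suc i) = let (b , j) = untag i in b ∷ decodeList L j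

decodeList-encodeList : ∀ L w → length w ≤ L → decodeList L (encodeList L w) ≡ w
decodeList-encodeList zero    []      _ = refl
decodeList-encodeList (suc L) []      _ = refl
decodeList-encodeList (suc L) (b ∷ w) (s≤s p)
  rewrite untag-tag b (encodeList L w) = cong (b ∷_) (decodeList-encodeList L w p)

suc-countLists≤ : ∀ L → suc (countLists≤ L) ≡ 2 ^ suc L
suc-countLists≤ zero    = refl
suc-countLists≤ (suc L) = begin
    suc (suc (countLists≤ L + countLists≤ L))
  ≡⟨ cong suc (sym (+-suc (countLists≤ L) (countLists≤ L))) ⟩
    suc (countLists≤ L) + suc (countLists≤ L)
  ≡⟨ cong (λ m → m + m) (suc-countLists≤ L) ⟩
    2 ^ suc L + 2 ^ suc L
  ≡⟨ cong (2 ^ suc L +_) (sym (+-identityʳ (2 ^ suc L))) ⟩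
    2 ^ suc (suc L)
  ∎
  where open ≡-Reasoning

m+m≡2*n⇒m≡n : ∀ {m n} → m + m ≡ 2 * n → m ≡ n
m+m≡2*n⇒m≡n {m} {n} eq = *-cancelˡ-≡ m n 2 (trans (cong (m +_) (+-identityʳ m)) eq)

m*4≡2*[2*m] : ∀ m → m * 4 ≡ 2 * (2 * m)
m*4≡2*[2*m] = solve-∀

m*4/2≡2*m : ∀ m → m * 4 / 2 ≡ 2 * m
m*4/2≡2*m m = trans (cong (_/ 2) (trans (m*4≡2*[2*m] m) (*-comm 2 (2 * m)))) (m*n/n≡m (2 * m) 2)

-- ahead s h t: the string fed by marker s (α for false, β for true) is the
-- other one followed by h ∷ t.
data Excess : Set where
  balanced : Excess
  ahead    : (side head : Bool) (tail : List Bool) → Excess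

-- The marker field holds the marker of the pair being read; it is junk after a value bit.
data State : Set where
  dead : State
  live : Excess → (marker : Bool) → State

αPart βPart : Bool → Bool → List Bool
αPart m v = if m then [] else v ∷ []
βPart m v = if m then v ∷ [] else []

Oriented : Bool → (List Bool → List Bool → Set) → List Bool → List Bool → Set
Oriented false R l f = R l f
Oriented true  R l f = R f l

oriented : ∀ s {R : List Bool → List Bool → Set} {l f} →
           (∀ {x y} → R x y → R y x) → R l f → Oriented s R l f
oriented false _   r = r
oriented true  sym r = sym r

remainder : Bool → List Bool → Excess
remainder s []      = balanced
remainder s (h ∷ t) = ahead s h t

shrink : Bool → Bool → List Bool → Bool → Maybe Excess
shrink s h t v with v Bool.≟ h
... | yes _ = just (remainder s t)
... | no _  = nothing

embed : Maybe Excess → State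
embed nothing  = dead
embed (just E) = live E false

withMarker : State → Bool → State
withMarker dead       _ = dead
withMarker (live E _) m = live E m

accept : State → Bool
accept (live balanced _) = true
accept _                 = false

GoodExcess : ℕ → Excess → Set
GoodExcess d balanced      = ⊤
GoodExcess d (ahead _ _ t) = length t < d

Good : ℕ → State → Set
Good d dead       = ⊤
Good d (live E _) = GoodExcess d E

module EqsAutomaton (d : ℕ) where

  grow : Bool → Bool → List Bool → Bool → Maybe Excess
  grow s h t v with length (t ++ v ∷ []) <? d
  ... | yes _ = just (ahead s h (t ++ v ∷ []))
  ... | no _  = nothing

  pairStep : Excess → Bool → Bool → Maybe Excess
  pairStep balanced          m     v = just (ahead m v [])
  pairStep (ahead false h t) false v = grow false h t v
  pairStep (ahead false h t) true  v = shrink false h t v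
  pairStep (ahead true  h t) false v = shrink true h t v
  pairStep (ahead true  h t) true  v = grow true h t v

  withValue : State → Bool → State
  withValue dead       _ = dead
  withValue (live E m) v = embed (pairStep E m v)

  -- Positions 2i and 2i+1 (i < P) carry the i-th marker and value; later ones are ignored.
  readBit : ℕ → ℕ → State → Bool → State
  readBit zero    _             s _ = s
  readBit (suc P) zero          s b = withMarker s b
  readBit (suc P) (suc zero)    s b = withValue s b
  readBit (suc P) (suc (suc j)) s b = readBit P j s b

  Unmatchable : List Bool → List Bool → Set
  Unmatchable a b = ∀ X Y → a ++ X ≡ b ++ Y → length (a ++ X) ≢ d

  Inv : Maybe Excess → List Bool → List Bool → Set
  Inv nothing                a b = Unmatchable a b
  Inv (just balanced)        a b = a ≡ b
  Inv (just (ahead s h t))   a b = Oriented s (λ l f → l ≡ f ++ h ∷ t) a b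

  unmatchable-++ : ∀ {a b} A B → Unmatchable a b → Unmatchable (a ++ A) (b ++ B)
  unmatchable-++ {a} {b} A B u X Y eq rewrite ++-assoc a A X =
    u (A ++ X) (B ++ Y) (trans eq (++-assoc b B Y))

  unmatchable-sym : ∀ {a b} → Unmatchable a b → Unmatchable b a
  unmatchable-sym {a} {b} u X Y eq = u Y X (sym eq) ∘ trans (cong length (sym eq))

  unmatchable-long : ∀ {a} b → d < length a → Unmatchable a b
  unmatchable-long {a} _ d<a X _ _ len≡d =
    <-irrefl (sym len≡d) (<-≤-trans d<a (length-++-≤ˡ a))

  unmatchable-mismatch : ∀ c {x y} xs ys → x ≢ y → Unmatchable (c ++ x ∷ xs) (c ++ y ∷ ys)
  unmatchable-mismatch c xs ys x≢y X Y eq _ =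
    x≢y (∷-injectiveˡ (++-cancelˡ c _ _
      (trans (sym (++-assoc c _ X)) (trans eq (++-assoc c _ Y)))))

  lead : ∀ s {h t l f} → l ≡ f ++ h ∷ t → Oriented s (Inv (just (ahead s h t))) l f
  lead false eq = eq
  lead true  eq = eq

  remainder-inv : ∀ s t {l f} → l ≡ f ++ t → Oriented s (Inv (just (remainder s t))) l f
  remainder-inv s []      {l} {f} eq = oriented s sym (trans eq (++-identityʳ f))
  remainder-inv s (h ∷ t)         eq = lead s eq

  grow-inv : ∀ s h t v {f} →
             Oriented s (Inv (grow s h t v)) ((f ++ h ∷ t) ++ v ∷ []) (f ++ [])
  grow-inv s h t v {f} with length (t ++ v ∷ []) <? d
  ... | yes _ = lead s (begin
        (f ++ h ∷ t) ++ v ∷ []   ≡⟨ ++-assoc f (h ∷ t) (v ∷ []) ⟩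
        f ++ h ∷ t ++ v ∷ []     ≡⟨ cong (_++ h ∷ t ++ v ∷ []) (sym (++-identityʳ f)) ⟩
        (f ++ []) ++ h ∷ t ++ v ∷ [] ∎)
    where open ≡-Reasoning
  ... | no too-long = oriented s unmatchable-sym (unmatchable-long (f ++ []) (begin-strict
        d                              ≤⟨ ≮⇒≥ too-long ⟩
        length (t ++ v ∷ [])           <⟨ n<1+n _ ⟩
        length (h ∷ t ++ v ∷ [])       ≤⟨ length-++-≤ʳ (h ∷ t ++ v ∷ []) {f} ⟩
        length (f ++ h ∷ t ++ v ∷ [])  ≡⟨ cong length (sym (++-assoc f (h ∷ t) (v ∷ []))) ⟩
        length ((f ++ h ∷ t) ++ v ∷ []) ∎))
    where open ≤-Reasoning

  shrink-inv : ∀ s h t v {f} →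
               Oriented s (Inv (shrink s h t v)) ((f ++ h ∷ t) ++ []) (f ++ v ∷ [])
  shrink-inv s h t v {f} with v Bool.≟ h
  ... | yes refl = remainder-inv s t (begin
        (f ++ h ∷ t) ++ []    ≡⟨ ++-identityʳ _ ⟩
        f ++ h ∷ t            ≡⟨ sym (++-assoc f (h ∷ []) t) ⟩
        (f ++ h ∷ []) ++ t    ∎)
    where open ≡-Reasoning
  ... | no v≢h = oriented s unmatchable-sym
        (subst (λ a → Unmatchable a (f ++ v ∷ [])) (sym (++-assoc f (h ∷ t) []))
          (unmatchable-mismatch f (t ++ []) [] (v≢h ∘ sym)))

  pairStep-inv : ∀ E m v {a b} → Inv (just E) a b →
                 Inv (pairStep E m v) (a ++ αPart m v) (b ++ βPart m v)
  pairStep-inv balanced          false v {a} refl = cong (_++ v ∷ []) (sym (++-identityʳ a))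
  pairStep-inv balanced          true  v {a} refl = cong (_++ v ∷ []) (sym (++-identityʳ a))
  pairStep-inv (ahead false h t) false v refl = grow-inv false h t v
  pairStep-inv (ahead false h t) true  v refl = shrink-inv false h t v
  pairStep-inv (ahead true  h t) false v refl = shrink-inv true h t v
  pairStep-inv (ahead true  h t) true  v refl = grow-inv true h t v

  bind-inv : ∀ x m v {a b} → Inv x a b →
             Inv (x >>= λ E → pairStep E m v) (a ++ αPart m v) (b ++ βPart m v)
  bind-inv nothing  m v u = unmatchable-++ (αPart m v) (βPart m v) u
  bind-inv (just E) m v r = pairStep-inv E m v r

  verdict : ∀ x {a b} → Inv x a b → length a + length b ≡ 2 * d →
            accept (embed x) ≡ ⌊ ≡-dec Bool._≟_ a b ⌋
  verdict x {a} {b} inv total with ≡-dec Bool._≟_ a b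
  verdict nothing              {a} u total | yes refl =
    ⊥-elim (u [] [] refl (trans (cong length (++-identityʳ a)) (m+m≡2*n⇒m≡n total)))
  verdict (just balanced)      _     total | yes _    = refl
  verdict (just (ahead s h t)) {a} r total | yes refl = ⊥-elim (h∷t≢[] (++-identityʳ-unique a (self s r)))
    where
    self : ∀ s → Oriented s (λ l f → l ≡ f ++ h ∷ t) a a → a ≡ a ++ h ∷ t
    self false r = r
    self true  r = r
    h∷t≢[] : h ∷ t ≢ []
    h∷t≢[] ()
  verdict nothing              _     total | no _     = refl
  verdict (just balanced)      r     total | no a≢b   = ⊥-elim (a≢b r)
  verdict (just (ahead _ _ _)) _     total | no _     = refl

  module _ {n : ℕ} (ν : Fin n → Bool) where

    marker value : ℕ → Bool
    marker i = bitAt ν (2 * i)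
    value  i = bitAt ν (2 * i + 1)

    pairRun : ℕ → Maybe Excess
    pairRun zero    = just balanced
    pairRun (suc i) = pairRun i >>= λ E → pairStep E (marker i) (value i)

    pairRun-inv : ∀ i → Inv (pairRun i) (alphaPre ν i) (betaPre ν i)
    pairRun-inv zero    = refl
    pairRun-inv (suc i) = bind-inv (pairRun i) (marker i) (value i) (pairRun-inv i)

    length-parts : ∀ m v a b →
      length (a ++ αPart m v) + length (b ++ βPart m v) ≡ suc (length a + length b)
    length-parts false v a b rewrite length-++ a {v ∷ []} | ++-identityʳ b =
      cong (_+ length b) (+-comm (length a) 1)
    length-parts true  v a b rewrite length-++ b {v ∷ []} | ++-identityʳ a =
      trans (cong (length a +_) (+-comm (length b) 1)) (+-suc (length a) (length b))

    length-prefixes : ∀ i → length (alphaPre ν i) + length (betaPre ν i) ≡ i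
    length-prefixes zero    = refl
    length-prefixes (suc i) = trans (length-parts (marker i) (value i) (alphaPre ν i) (betaPre ν i))
                                    (cong suc (length-prefixes i))

    pairRun-verdict : accept (embed (pairRun (2 * d))) ≡
                      ⌊ ≡-dec Bool._≟_ (alphaPre ν (2 * d)) (betaPre ν (2 * d)) ⌋
    pairRun-verdict = verdict (pairRun (2 * d)) (pairRun-inv (2 * d)) (length-prefixes (2 * d))

  readBit-marker : ∀ {P} i → i < P → ∀ s b → readBit P (2 * i) s b ≡ withMarker s b
  readBit-marker {suc P} zero    _         s b = refl
  readBit-marker {suc P} (suc i) (s≤s i<P) s b =
    trans (cong (λ j → readBit (suc P) j s b) (*-suc 2 i)) (readBit-marker i i<P s b)

  readBit-value : ∀ {P} i → i < P → ∀ s b → readBit P (suc (2 * i)) s b ≡ withValue s b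
  readBit-value {suc P} zero    _         s b = refl
  readBit-value {suc P} (suc i) (s≤s i<P) s b =
    trans (cong (λ j → readBit (suc P) (suc j) s b) (*-suc 2 i)) (readBit-value i i<P s b)

  readBit-done : ∀ P j s b → readBit P (2 * P + j) s b ≡ s
  readBit-done zero    j s b = refl
  readBit-done (suc P) j s b =
    trans (cong (λ i → readBit (suc P) (i + j) s b) (*-suc 2 P)) (readBit-done P j s b)

  eqsRun : (ℕ → Bool) → ℕ → State
  eqsRun = run (live balanced false) (readBit (2 * d))

  withValue-withMarker : ∀ x m v →
    withValue (withMarker (embed x) m) v ≡ embed (x >>= λ E → pairStep E m v)
  withValue-withMarker nothing  m v = refl
  withValue-withMarker (just E) m v = refl

  eqsRun-pairs : ∀ {n} (ν : Fin n → Bool) i → i ≤ 2 * d →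
                 eqsRun (bitAt ν) (2 * i) ≡ embed (pairRun ν i)
  eqsRun-pairs ν zero    _  = refl
  eqsRun-pairs ν (suc i) i<K = begin
      eqsRun x (2 * suc i)
    ≡⟨ cong (eqsRun x) (*-suc 2 i) ⟩
      readBit K (suc (2 * i)) (readBit K (2 * i) (eqsRun x (2 * i)) (x (2 * i))) (x (suc (2 * i)))
    ≡⟨ readBit-value i i<K _ _ ⟩
      withValue (readBit K (2 * i) (eqsRun x (2 * i)) (x (2 * i))) (x (suc (2 * i)))
    ≡⟨ cong₂ withValue (readBit-marker i i<K _ _) (cong x (+-comm 1 (2 * i))) ⟩
      withValue (withMarker (eqsRun x (2 * i)) (marker ν i)) (value ν i)
    ≡⟨ cong (λ s → withValue (withMarker s (marker ν i)) (value ν i)) (eqsRun-pairs ν i (<⇒≤ i<K)) ⟩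
      withValue (withMarker (embed (pairRun ν i)) (marker ν i)) (value ν i)
    ≡⟨ withValue-withMarker (pairRun ν i) (marker ν i) (value ν i) ⟩
      embed (pairRun ν (suc i))
    ∎
    where
    open ≡-Reasoning
    K = 2 * d
    x = bitAt ν

  eqsRun-done : ∀ x j → eqsRun x (2 * (2 * d) + j) ≡ eqsRun x (2 * (2 * d))
  eqsRun-done x zero    = cong (eqsRun x) (+-identityʳ (2 * (2 * d)))
  eqsRun-done x (suc j) = begin
      eqsRun x (2 * (2 * d) + suc j)    ≡⟨ cong (eqsRun x) (+-suc (2 * (2 * d)) j) ⟩
      eqsRun x (suc (2 * (2 * d) + j))  ≡⟨ readBit-done (2 * d) j _ _ ⟩
      eqsRun x (2 * (2 * d) + j)        ≡⟨ eqsRun-done x j ⟩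
      eqsRun x (2 * (2 * d))            ∎
    where open ≡-Reasoning

  eqsRun-computes : ∀ {n} → d * 4 ≤ n → ∀ ν → accept (eqsRun (bitAt ν) n) ≡ EQS (d * 4) n ν
  eqsRun-computes {n} k≤n ν = begin
      accept (eqsRun (bitAt ν) n)
    ≡⟨ cong (accept ∘ eqsRun (bitAt ν)) (sym (m+[n∸m]≡n 4d≤n)) ⟩
      accept (eqsRun (bitAt ν) (2 * (2 * d) + (n ∸ 2 * (2 * d))))
    ≡⟨ cong accept (eqsRun-done (bitAt ν) (n ∸ 2 * (2 * d))) ⟩
      accept (eqsRun (bitAt ν) (2 * (2 * d)))
    ≡⟨ cong accept (eqsRun-pairs ν (2 * d) ≤-refl) ⟩
      accept (embed (pairRun ν (2 * d)))
    ≡⟨ pairRun-verdict ν ⟩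
      ⌊ ≡-dec Bool._≟_ (alphaPre ν (2 * d)) (betaPre ν (2 * d)) ⌋
    ≡⟨ cong (λ K → ⌊ ≡-dec Bool._≟_ (alphaPre ν K) (betaPre ν K) ⌋) (sym (m*4/2≡2*m d)) ⟩
      EQS (d * 4) n ν
    ∎
    where
    open ≡-Reasoning
    4d≤n : 2 * (2 * d) ≤ n
    4d≤n = subst (_≤ n) (m*4≡2*[2*m] d) k≤n

  grow-good : ∀ s h t v → Good d (embed (grow s h t v))
  grow-good s h t v with length (t ++ v ∷ []) <? d
  ... | yes fits = fits
  ... | no _     = tt

  shrink-good : ∀ s h t v → length t < d → Good d (embed (shrink s h t v))
  shrink-good s h t v t<d with v Bool.≟ h
  shrink-good s h []      v t<d | yes _ = tt
  shrink-good s h (_ ∷ t) v t<d | yes _ = <-trans (n<1+n (length t)) t<d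
  ... | no _ = tt

  pairStep-good : 0 < d → ∀ E m v → GoodExcess d E → Good d (embed (pairStep E m v))
  pairStep-good 0<d balanced          m     v _   = 0<d
  pairStep-good _   (ahead false h t) false v _   = grow-good false h t v
  pairStep-good _   (ahead false h t) true  v t<d = shrink-good false h t v t<d
  pairStep-good _   (ahead true  h t) false v t<d = shrink-good true h t v t<d
  pairStep-good _   (ahead true  h t) true  v _   = grow-good true h t v

  readBit-good : 0 < d → ∀ P j s b → Good d s → Good d (readBit P j s b)
  readBit-good _   zero    _             s          _ good = good
  readBit-good _   (suc P) zero          dead       _ _    = tt
  readBit-good _   (suc P) zero          (live E _) _ good = good
  readBit-good _   (suc P) (suc zero)    dead       _ _    = tt
  readBit-good 0<d (suc P) (suc zero)    (live E m) v good = pairStep-good 0<d E m v good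
  readBit-good 0<d (suc P) (suc (suc j)) s          b good = readBit-good 0<d P j s b good

countExcess : ℕ → ℕ
countExcess e = suc ((c + c) + (c + c))
  where c = countLists≤ e

countStates : ℕ → ℕ
countStates e = suc (countExcess e + countExcess e)

encodeExcess : (e : ℕ) → Excess → Fin (countExcess e)
encodeExcess e balanced      = zero
encodeExcess e (ahead s h t) = suc (tag s (tag h (encodeList e t)))

decodeExcess : (e : ℕ) → Fin (countExcess e) → Excess
decodeExcess e zero    = balanced
decodeExcess e (suc i) = let (s , j) = untag i ; (h , l) = untag j in ahead s h (decodeList e l)

decodeExcess-encodeExcess : ∀ e E → GoodExcess (suc e) E → decodeExcess e (encodeExcess e E) ≡ E
decodeExcess-encodeExcess e balanced      _ = refl
decodeExcess-encodeExcess e (ahead s h t) (s≤s t≤e)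
  rewrite untag-tag s (tag h (encodeList e t)) | untag-tag h (encodeList e t) =
  cong (ahead s h) (decodeList-encodeList e t t≤e)

encodeState : (e : ℕ) → State → Fin (countStates e)
encodeState e dead       = zero
encodeState e (live E m) = suc (tag m (encodeExcess e E))

decodeState : (e : ℕ) → Fin (countStates e) → State
decodeState e zero    = dead
decodeState e (suc i) = let (m , j) = untag i in live (decodeExcess e j) m

decodeState-encodeState : ∀ e s → Good (suc e) s → decodeState e (encodeState e s) ≡ s
decodeState-encodeState e dead       _    = refl
decodeState-encodeState e (live E m) good rewrite untag-tag m (encodeExcess e E) =
  cong (λ E → live E m) (decodeExcess-encodeExcess e E good)

countStates≡ : ∀ e → countStates e ≡ 8 * 2 ^ suc e ∸ 5
countStates≡ e = begin
    countStates e                          ≡⟨ sym (m+n∸n≡m (countStates e) 5) ⟩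
    countStates e + 5 ∸ 5                  ≡⟨ cong (_∸ 5) (count (countLists≤ e)) ⟩
    8 * suc (countLists≤ e) ∸ 5            ≡⟨ cong (λ m → 8 * m ∸ 5) (suc-countLists≤ e) ⟩
    8 * 2 ^ suc e ∸ 5                      ∎
  where
  open ≡-Reasoning
  count : ∀ c → suc (suc ((c + c) + (c + c)) + suc ((c + c) + (c + c))) + 5 ≡ 8 * suc c
  count = solve-∀

eqsAutomaton : (e : ℕ) → Automaton State (countStates e)
eqsAutomaton e = record
  { Good          = Good (suc e)
  ; start         = live balanced false
  ; step          = readBit (2 * suc e)
  ; accept        = accept
  ; encode        = encodeState e
  ; decode        = decodeState e
  ; start-good    = tt
  ; step-good     = readBit-good z<s (2 * suc e)
  ; decode-encode = decodeState-encodeState e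
  }
  where open EqsAutomaton (suc e)

lemma6 : (n k : ℕ) → 4 ∣ k → 4 ≤ k → k ^ 4 ≤ 2 ^ n → k ≤ n →
    Σ (OBDD n) λ B → OBDD.HasWidthAtMost B (8 * 2 ^ (k / 4) ∸ 5)
      × OBDD.Computes B (EQS k n)
lemma6 n .(zero * 4)  (divides zero    refl) () _ _
lemma6 n .(suc e * 4) (divides (suc e) refl) _  _ k≤n =
  subst (λ w → Σ (OBDD n) λ B → OBDD.HasWidthAtMost B w × OBDD.Computes B (EQS (suc e * 4) n))
        (trans (countStates≡ e) (cong (λ q → 8 * 2 ^ q ∸ 5) (sym (m*n/n≡m (suc e) 4))))
        (automaton⇒OBDD (eqsAutomaton e) n (EqsAutomaton.eqsRun-computes (suc e) k≤n))
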